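{- Let $R$ and $S$ be reduced commutative rings with identity. If $\Gamma(R)\cong\Gamma(S)$, then $Mdim(\Gamma_E(R)) = Mdim(\Gamma_E(S))$.
   Context: A ring is reduced if it has no nonzero nilpotent elements. For a commutative ring $R$ with identity $1\neq 0$, $Z(R)$ denotes its set of zero-divisors (including $0$) and $Z^*(R)=Z(R)\setminus\{0\}$. The zero-divisor graph $\Gamma(R)$ is the simple graph with vertex set $Z^*(R)$ in which distinct $x,y$ are adjacent iff $xy=0$. For $x\in R$ let $[x]=\{y\in R : \mathrm{ann}(x)=\mathrm{ann}(y)\}$. The compressed zero-divisor graph $\Gamma_E(R)$ is the simple graph whose vertices are the classes $[x]$ with $x\in Z(R)\setminus\{0\}$, distinct classes $[x],[y]$ being adjacent iff $xy=0$. For a connected graph $G$, a vertex $v$ and $W\subseteq V(G)$, the multiset representation of $v$ with respect to $W$ is the multiset $\{d(v,w): w\in W\}$ of distances (with multiplicities). $W$ is an m-resolving set if distinct vertices have distinct multiset representations. $Mdim(G)$ is the minimum cardinality of an m-resolving set, with $Mdim(G)=\infty$ if none exists; $Mdim$ of a single-vertex graph is $0$ and it is undefined for the empty graph. -}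

module Defs where

open import Level using (Level; _⊔_) renaming (suc to lsuc)
open import Relation.Binary.PropositionalEquality using (_≡_)
open import Data.Nat using (ℕ; zero; suc; _≤_)
open import Data.Fin using (Fin)
open import Data.Fin.Permutation using (Permutation′; _⟨$⟩ʳ_)
open import Data.Product using (Σ; ∃; _×_; _,_; proj₁)
open import Relation.Nullary using (¬_)
open import Function.Bundles using (_⇔_)
open import Algebra.Bundles using (CommutativeRing)

private variable c ℓ a b c₂ ℓ₂ : Level

module _ (R : CommutativeRing c ℓ) where
  open CommutativeRing R

  pow : Carrier → ℕ → Carrier
  pow x zero    = 1#
  pow x (suc n) = x * pow x n

  NontrivialRing : Set ℓ
  NontrivialRing = ¬ (1# ≈ 0#)

  Reduced : Set (c ⊔ ℓ)
  Reduced = (x : Carrier) (n : ℕ) → pow x n ≈ 0# → x ≈ 0#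

  ZeroDivisor : Carrier → Set (c ⊔ ℓ)
  ZeroDivisor x = Σ Carrier λ y → ¬ (y ≈ 0#) × (x * y ≈ 0#)

  NZZeroDivisor : Carrier → Set (c ⊔ ℓ)
  NZZeroDivisor x = ZeroDivisor x × ¬ (x ≈ 0#)

  SameAnn : Carrier → Carrier → Set (c ⊔ ℓ)
  SameAnn x y = (z : Carrier) → (x * z ≈ 0#) ⇔ (y * z ≈ 0#)

-- Simple graphs whose vertex "set" is a type with an equivalence
-- relation (vertex identity); Adj is the (irreflexive, symmetric)
-- adjacency relation.

record Graph (a b : Level) : Set (lsuc (a ⊔ b)) where
  field
    V   : Set a
    _≃_ : V → V → Set b
    Adj : V → V → Set b

ZDGraph : CommutativeRing c ℓ → Graph (c ⊔ ℓ) ℓ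
ZDGraph R = record
  { V   = Σ Carrier (NZZeroDivisor R)
  ; _≃_ = λ x y → proj₁ x ≈ proj₁ y
  ; Adj = λ x y → ¬ (proj₁ x ≈ proj₁ y) × (proj₁ x * proj₁ y ≈ 0#)
  }
  where open CommutativeRing R

-- compressed zero-divisor graph Γ_E(R): vertices are the classes [x],
-- x ∈ Z(R)\{0}, represented by x with vertex identity ann(x) = ann(y);
-- distinct classes [x],[y] adjacent iff xy = 0
CZDGraph : {c' ℓ' : Level} → CommutativeRing c' ℓ' → Graph (c' ⊔ ℓ') (c' ⊔ ℓ')
CZDGraph {c'} {ℓ'} R = record
  { V   = Σ Carrier (NZZeroDivisor R)
  ; _≃_ = λ x y → SameAnn R (proj₁ x) (proj₁ y)
  ; Adj = λ x y → ¬ (SameAnn R (proj₁ x) (proj₁ y))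
                  × Lift′ (proj₁ x * proj₁ y ≈ 0#)
  }
  where
  open CommutativeRing R
  Lift′ : Set ℓ' → Set (c' ⊔ ℓ')
  Lift′ A = Level.Lift c' A

record _≅_ (G : Graph a b) (H : Graph c₂ ℓ₂) : Set (a ⊔ b ⊔ c₂ ⊔ ℓ₂) where
  private
    module G = Graph G
    module H = Graph H
  field
    to        : G.V → H.V
    from      : H.V → G.V
    to-cong   : ∀ {x y} → x G.≃ y → to x H.≃ to y
    from-cong : ∀ {x y} → x H.≃ y → from x G.≃ from y
    from-to   : ∀ x → from (to x) G.≃ x
    to-from   : ∀ y → to (from y) H.≃ y
    adj       : ∀ x y → G.Adj x y ⇔ H.Adj (to x) (to y)

module _ (G : Graph a b) where
  open Graph G

  data Walk : V → V → ℕ → Set (a ⊔ b) where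
    here  : ∀ {u v} → u ≃ v → Walk u v zero
    there : ∀ {u w v k} → Adj u w → Walk w v k → Walk u v (suc k)

  Dist : V → V → ℕ → Set (a ⊔ b)
  Dist u v k = Walk u v k × (∀ m → Walk u v m → k ≤ m)

  -- u and v have the same multiset representation w.r.t. W
  -- (W listed as W 0, …, W (n-1)): the multisets {d(u,W i)} and
  -- {d(v,W i)} agree, i.e. some permutation π matches them.
  SameRep : {n : ℕ} → (Fin n → V) → V → V → Set (a ⊔ b)
  SameRep {n} W u v =
    Σ (Permutation′ n) λ π → ∀ i k → Dist u (W i) k ⇔ Dist v (W (π ⟨$⟩ʳ i)) k

  Distinct : {n : ℕ} → (Fin n → V) → Set b
  Distinct W = ∀ i j → W i ≃ W j → i ≡ j

  MResolving : {n : ℕ} → (Fin n → V) → Set (a ⊔ b)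
  MResolving W = ∀ u v → SameRep W u v → u ≃ v

  -- Mdim(G) = n (finite value): some m-resolving set of size n,
  -- and every (finite) m-resolving set has size ≥ n
  HasMdim : ℕ → Set (a ⊔ b)
  HasMdim n =
    (Σ (Fin n → V) λ W → Distinct W × MResolving W)
    × (∀ m (W : Fin m → V) → Distinct W → MResolving W → n ≤ m)

-- In a reduced ring a nonzero x never annihilates itself, so the open neighbourhood of x in Γ(R)
-- is exactly ann(x) ∖ {0}. An inclusion ann(x) ∖ {0} ⊆ ann(y) already forces ann(x) ⊆ ann(y),
-- so two vertices of Γ(R) have the same annihilator iff they have the same neighbourhood, a
-- purely graph-theoretic condition. Hence an isomorphism Γ(R) ≅ Γ(S) descends to
-- Γ_E(R) ≅ Γ_E(S), and the multiset dimension Mdim is invariant under graph isomorphism.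
{-# OPTIONS --safe #-}
module Submission where

open import Defs
open import Level using (Level; _⊔_; Lift; lift; lower)
open import Data.Nat using (ℕ)
open import Data.Fin using (Fin)
open import Data.Fin.Permutation using (_⟨$⟩ʳ_)
open import Data.Product using (_×_; _,_; proj₁; proj₂)
open import Data.Product.Function.NonDependent.Propositional using (_×-⇔_)
open import Function.Base using (_∘_)
open import Function.Bundles using (_⇔_; mk⇔; Equivalence)
open import Function.Construct.Composition using (_⇔-∘_)
open import Function.Construct.Identity using (⇔-id)
open import Function.Construct.Symmetry using (⇔-sym)
open import Function.Related.Propositional using (equivalence; module EquationalReasoning)
open import Function.Related.TypeIsomorphisms using (¬-cong-⇔)
open import Relation.Binary.Structures using (IsEquivalence)
import Relation.Binary.Construct.On as On
open import Relation.Nullary using (¬_)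
open import Algebra.Bundles using (CommutativeRing)

private
  variable
    a b a′ b′ c ℓ c′ ℓ′ : Level
  module ⇔ = Equivalence

Lift-cong-⇔ : {A : Set a} {B : Set b} → A ⇔ B → Lift ℓ A ⇔ Lift ℓ′ B
Lift-cong-⇔ A⇔B = mk⇔ (lift ∘ ⇔.to A⇔B ∘ lower) (lift ∘ ⇔.from A⇔B ∘ lower)

record IsSetoidGraph (G : Graph a b) : Set (a ⊔ b) where
  open Graph G
  field
    isEquivalence : IsEquivalence _≃_
    Adj-resp-≃    : ∀ {x x′ y y′} → x ≃ x′ → y ≃ y′ → Adj x y → Adj x′ y′
  open IsEquivalence isEquivalence public

Nbhd⊆ : (G : Graph a b) → Graph.V G → Graph.V G → Set (a ⊔ b)
Nbhd⊆ G x y = ∀ w → Adj x w → Adj y w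
  where open Graph G

Walk-resp-≃ : {G : Graph a b} → IsSetoidGraph G → ∀ {u u′ v v′ k} →
  Graph._≃_ G u u′ → Graph._≃_ G v v′ → Walk G u v k → Walk G u′ v′ k
Walk-resp-≃ G-setoid u≃u′ v≃v′ (here u≃v)    = here (trans (sym u≃u′) (trans u≃v v≃v′))
  where open IsSetoidGraph G-setoid
Walk-resp-≃ G-setoid u≃u′ v≃v′ (there u~w w⇝v) =
  there (Adj-resp-≃ u≃u′ refl u~w) (Walk-resp-≃ G-setoid refl v≃v′ w⇝v)
  where open IsSetoidGraph G-setoid

Walk⇔⇒Dist⇔ : {G : Graph a b} {H : Graph a′ b′} {u v : Graph.V G} {u′ v′ : Graph.V H} →
  (∀ {k} → Walk G u v k ⇔ Walk H u′ v′ k) → ∀ {k} → Dist G u v k ⇔ Dist H u′ v′ k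
Walk⇔⇒Dist⇔ walks = mk⇔
  (λ (p , shortest) → ⇔.to walks p   , λ m q → shortest m (⇔.from walks q))
  (λ (p , shortest) → ⇔.from walks p , λ m q → shortest m (⇔.to walks q))

module _ {G : Graph a b} {H : Graph a′ b′} (f : G ≅ H) where
  open _≅_ f

  Walk-map : ∀ {u v k} → Walk G u v k → Walk H (to u) (to v) k
  Walk-map (here u≃v)      = here (to-cong u≃v)
  Walk-map (there u~w w⇝v) = there (⇔.to (adj _ _) u~w) (Walk-map w⇝v)

≅-sym : {G : Graph a b} {H : Graph a′ b′} → IsSetoidGraph H → G ≅ H → H ≅ G
≅-sym H-setoid f = record
  { to        = from
  ; from      = to
  ; to-cong   = from-cong
  ; from-cong = to-cong
  ; from-to   = to-from
  ; to-from   = from-to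
  ; adj       = λ x y → mk⇔
      (λ x~y → ⇔.from (adj (from x) (from y))
                 (Adj-resp-≃ (sym (to-from x)) (sym (to-from y)) x~y))
      (λ x~y → Adj-resp-≃ (to-from x) (to-from y) (⇔.to (adj (from x) (from y)) x~y))
  }
  where
  open _≅_ f
  open IsSetoidGraph H-setoid

module IsoProperties {G : Graph a b} {H : Graph a′ b′}
  (G-setoid : IsSetoidGraph G) (H-setoid : IsSetoidGraph H) (f : G ≅ H) where
  private
    module G = IsSetoidGraph G-setoid
    module H = IsSetoidGraph H-setoid
  open Graph G using (V)
  open Graph H using (_≃_)
  open _≅_ f

  to-reflects-≃ : ∀ {x y} → to x ≃ to y → Graph._≃_ G x y
  to-reflects-≃ {x} {y} e = G.trans (G.sym (from-to x)) (G.trans (from-cong e) (from-to y))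

  from-reflects-≃ : ∀ {x y} → Graph._≃_ G (from x) (from y) → x ≃ y
  from-reflects-≃ {x} {y} e = H.trans (H.sym (to-from x)) (H.trans (to-cong e) (to-from y))

  Walk-≅ : ∀ {u v u′ v′ k} → to u ≃ u′ → to v ≃ v′ → Walk G u v k ⇔ Walk H u′ v′ k
  Walk-≅ u↦u′ v↦v′ = mk⇔
    (Walk-resp-≃ H-setoid u↦u′ v↦v′ ∘ Walk-map f)
    (Walk-resp-≃ G-setoid (back u↦u′) (back v↦v′) ∘ Walk-map (≅-sym H-setoid f))
    where
    back : ∀ {x x′} → to x ≃ x′ → Graph._≃_ G (from x′) x
    back {x} x↦x′ = G.trans (from-cong (H.sym x↦x′)) (from-to x)

  Dist-≅ : ∀ {u v u′ v′ k} → to u ≃ u′ → to v ≃ v′ → Dist G u v k ⇔ Dist H u′ v′ k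
  Dist-≅ u↦u′ v↦v′ = Walk⇔⇒Dist⇔ (Walk-≅ u↦u′ v↦v′)

  Nbhd⊆-≅ : ∀ {x y} → Nbhd⊆ G x y ⇔ Nbhd⊆ H (to x) (to y)
  Nbhd⊆-≅ {x} {y} = mk⇔
    (λ x⊆y w x~w → Adj-back (to-from w) (⇔.to (adj y (from w))
                     (x⊆y (from w) (⇔.from (adj x (from w)) (Adj-back (H.sym (to-from w)) x~w)))))
    (λ x⊆y w x~w → ⇔.from (adj y w) (x⊆y (to w) (⇔.to (adj x w) x~w)))
    where
    Adj-back : ∀ {z w w′} → w ≃ w′ → Graph.Adj H z w → Graph.Adj H z w′
    Adj-back = H.Adj-resp-≃ H.refl

  Distinct-map : ∀ {n} {W : Fin n → V} → Distinct G W → Distinct H (to ∘ W)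
  Distinct-map distinct i j = distinct i j ∘ to-reflects-≃

  MResolving-map : ∀ {n} {W : Fin n → V} → MResolving G W → MResolving H (to ∘ W)
  MResolving-map {W = W} resolves u′ v′ (π , same) =
    from-reflects-≃ (resolves (from u′) (from v′) (π , same′))
    where
    open EquationalReasoning {k = equivalence}
    same′ : ∀ i k → Dist G (from u′) (W i) k ⇔ Dist G (from v′) (W (π ⟨$⟩ʳ i)) k
    same′ i k = begin
      Dist G (from u′) (W i) k              ∼⟨ Dist-≅ (to-from u′) H.refl ⟩
      Dist H u′ (to (W i)) k                ∼⟨ same i k ⟩
      Dist H v′ (to (W (π ⟨$⟩ʳ i))) k       ∼⟨ ⇔-sym (Dist-≅ (to-from v′) H.refl) ⟩
      Dist G (from v′) (W (π ⟨$⟩ʳ i)) k     ∎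

HasMdim-map : {G : Graph a b} {H : Graph a′ b′} → IsSetoidGraph G → IsSetoidGraph H →
  G ≅ H → ∀ {n} → HasMdim G n → HasMdim H n
HasMdim-map G-setoid H-setoid f ((W , distinct , resolves) , minimal) =
  (to ∘ W , Distinct-map distinct , MResolving-map resolves) ,
  λ m W′ distinct′ resolves′ →
    minimal m (from ∘ W′) (f⁻¹.Distinct-map distinct′) (f⁻¹.MResolving-map resolves′)
  where
  open _≅_ f
  open IsoProperties G-setoid H-setoid f
  module f⁻¹ = IsoProperties H-setoid G-setoid (≅-sym H-setoid f)

HasMdim-≅ : {G : Graph a b} {H : Graph a′ b′} → IsSetoidGraph G → IsSetoidGraph H →
  G ≅ H → ∀ n → HasMdim G n ⇔ HasMdim H n
HasMdim-≅ G-setoid H-setoid f _ =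
  mk⇔ (HasMdim-map G-setoid H-setoid f) (HasMdim-map H-setoid G-setoid (≅-sym H-setoid f))

module Annihilators (R : CommutativeRing c ℓ) where
  open CommutativeRing R

  Ann⊆ : Carrier → Carrier → Set (c ⊔ ℓ)
  Ann⊆ x y = ∀ z → x * z ≈ 0# → y * z ≈ 0#

  SameAnn⇔Ann⊆×Ann⊆ : ∀ {x y} → SameAnn R x y ⇔ (Ann⊆ x y × Ann⊆ y x)
  SameAnn⇔Ann⊆×Ann⊆ = mk⇔
    (λ same → (λ z → ⇔.to (same z)) , (λ z → ⇔.from (same z)))
    (λ (x⊆y , y⊆x) z → mk⇔ (x⊆y z) (y⊆x z))

  ≈⇒SameAnn : ∀ {x y} → x ≈ y → SameAnn R x y
  ≈⇒SameAnn x≈y z = mk⇔ (trans (*-congʳ (sym x≈y))) (trans (*-congʳ x≈y))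

  SameAnn-resp-≈ : ∀ {x x′ y y′} → x ≈ x′ → y ≈ y′ → SameAnn R x y → SameAnn R x′ y′
  SameAnn-resp-≈ {x} {x′} {y} {y′} x≈x′ y≈y′ same z =
    ≈⇒SameAnn {y} {y′} y≈y′ z ⇔-∘ (same z ⇔-∘ ≈⇒SameAnn {x′} {x} (sym x≈x′) z)

  SameAnn-isEquivalence : IsEquivalence (SameAnn R)
  SameAnn-isEquivalence = record
    { refl  = λ _ → ⇔-id _
    ; sym   = λ same z → ⇔-sym (same z)
    ; trans = λ same same′ z → same′ z ⇔-∘ same z
    }

  SameAnn-resp-*≈0 : ∀ {x x′ y y′} → SameAnn R x x′ → SameAnn R y y′ →
    x * y ≈ 0# → x′ * y′ ≈ 0#
  SameAnn-resp-*≈0 {x′ = x′} {y} {y′} x∼x′ y∼y′ xy≈0 =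
    trans (*-comm x′ y′) (⇔.to (y∼y′ x′) (trans (*-comm y x′) (⇔.to (x∼x′ y) xy≈0)))

ZDGraph-isSetoidGraph : (R : CommutativeRing c ℓ) → IsSetoidGraph (ZDGraph R)
ZDGraph-isSetoidGraph R = record
  { isEquivalence = On.isEquivalence proj₁ isEquivalence
  ; Adj-resp-≃    = λ x≈x′ y≈y′ (x≉y , xy≈0) →
      (λ x′≈y′ → x≉y (trans x≈x′ (trans x′≈y′ (sym y≈y′))))
      , trans (*-cong (sym x≈x′) (sym y≈y′)) xy≈0
  }
  where open CommutativeRing R

CZDGraph-isSetoidGraph : (R : CommutativeRing c ℓ) → IsSetoidGraph (CZDGraph R)
CZDGraph-isSetoidGraph R = record
  { isEquivalence = On.isEquivalence proj₁ SameAnn-isEquivalence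
  ; Adj-resp-≃    = λ x∼x′ y∼y′ (x≁y , lift xy≈0) →
      (λ x′∼y′ → x≁y (trans x∼x′ (trans x′∼y′ (sym y∼y′))))
      , lift (SameAnn-resp-*≈0 x∼x′ y∼y′ xy≈0)
  }
  where
  open Annihilators R
  open IsEquivalence SameAnn-isEquivalence

module ReducedRing (R : CommutativeRing c ℓ) (reduced : Reduced R) where
  open CommutativeRing R
  open Annihilators R
  open import Relation.Binary.Reasoning.Setoid setoid
  open Graph (ZDGraph R) using (V; Adj)

  x*x≈0⇒x≈0 : ∀ {x} → x * x ≈ 0# → x ≈ 0#
  x*x≈0⇒x≈0 {x} xx≈0 = reduced x 2 (trans (*-congˡ (*-identityʳ x)) xx≈0)

  *≈0⇒≉ : ∀ {x y} → ¬ x ≈ 0# → x * y ≈ 0# → ¬ x ≈ y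
  *≈0⇒≉ x≉0 xy≈0 x≈y = x≉0 (x*x≈0⇒x≈0 (trans (*-congˡ x≈y) xy≈0))

  Adj⇔*≈0 : (x y : V) → Adj x y ⇔ proj₁ x * proj₁ y ≈ 0#
  Adj⇔*≈0 x y = mk⇔ proj₂ (λ xy≈0 → *≈0⇒≉ (proj₂ (proj₂ x)) xy≈0 , xy≈0)

  x*[y+x*z]≈0⇒x*z≈0 : ∀ {x y z} → x * y ≈ 0# → x * (y + x * z) ≈ 0# → x * z ≈ 0#
  x*[y+x*z]≈0⇒x*z≈0 {x} {y} {z} xy≈0 x[y+xz]≈0 = x*x≈0⇒x≈0 (begin
    (x * z) * (x * z) ≈⟨ *-congʳ (*-comm x z) ⟩
    (z * x) * (x * z) ≈⟨ *-assoc z x (x * z) ⟩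
    z * (x * (x * z)) ≈⟨ *-congˡ xxz≈0 ⟩
    z * 0#            ≈⟨ zeroʳ z ⟩
    0#                ∎)
    where
    xxz≈0 : x * (x * z) ≈ 0#
    xxz≈0 = begin
      x * (x * z)           ≈⟨ +-identityˡ _ ⟨
      0# + x * (x * z)      ≈⟨ +-congʳ xy≈0 ⟨
      x * y + x * (x * z)   ≈⟨ distribˡ x y (x * z) ⟨
      x * (y + x * z)       ≈⟨ x[y+xz]≈0 ⟩
      0#                    ∎

  -- A witness c of a being a zero-divisor turns every z ∈ ann(a) into the element c + bz of
  -- ann(a), which is nonzero because b(c + bz) ≈ 0 would already force bz ≈ 0.
  nonzero-Ann⊆⇒Ann⊆ : ∀ {a b c} → ¬ c ≈ 0# → a * c ≈ 0# →
    (∀ w → ¬ w ≈ 0# → a * w ≈ 0# → b * w ≈ 0#) → Ann⊆ a b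
  nonzero-Ann⊆⇒Ann⊆ {a} {b} {c} c≉0 ac≈0 a⊆b z az≈0 =
    x*[y+x*z]≈0⇒x*z≈0 bc≈0 (a⊆b w w≉0 aw≈0)
    where
    bc≈0 : b * c ≈ 0#
    bc≈0 = a⊆b c c≉0 ac≈0

    w : Carrier
    w = c + b * z

    aw≈0 : a * w ≈ 0#
    aw≈0 = begin
      a * (c + b * z)       ≈⟨ distribˡ a c (b * z) ⟩
      a * c + a * (b * z)   ≈⟨ +-congʳ ac≈0 ⟩
      0# + a * (b * z)      ≈⟨ +-identityˡ _ ⟩
      a * (b * z)           ≈⟨ *-assoc a b z ⟨
      (a * b) * z           ≈⟨ *-congʳ (*-comm a b) ⟩
      (b * a) * z           ≈⟨ *-assoc b a z ⟩
      b * (a * z)           ≈⟨ *-congˡ az≈0 ⟩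
      b * 0#                ≈⟨ zeroʳ b ⟩
      0#                    ∎

    w≉0 : ¬ w ≈ 0#
    w≉0 w≈0 = c≉0 (begin
      c           ≈⟨ +-identityʳ c ⟨
      c + 0#      ≈⟨ +-congˡ bz≈0 ⟨
      c + b * z   ≈⟨ w≈0 ⟩
      0#          ∎)
      where
      bz≈0 : b * z ≈ 0#
      bz≈0 = x*[y+x*z]≈0⇒x*z≈0 bc≈0 (trans (*-congˡ w≈0) (zeroʳ b))

  Ann⊆⇔Nbhd⊆ : (x y : V) → Ann⊆ (proj₁ x) (proj₁ y) ⇔ Nbhd⊆ (ZDGraph R) x y
  Ann⊆⇔Nbhd⊆ x@(a , (c , c≉0 , ac≈0) , a≉0) y = mk⇔
    (λ x⊆y w x~w → ⇔.from (Adj⇔*≈0 y w) (x⊆y (proj₁ w) (⇔.to (Adj⇔*≈0 x w) x~w)))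
    (λ x⊆y → nonzero-Ann⊆⇒Ann⊆ c≉0 ac≈0 λ w w≉0 aw≈0 →
      let w∈Z* = w , (a , a≉0 , trans (*-comm w a) aw≈0) , w≉0
      in ⇔.to (Adj⇔*≈0 y w∈Z*) (x⊆y w∈Z* (⇔.from (Adj⇔*≈0 x w∈Z*) aw≈0)))

  SameAnn⇔Nbhd⊆×Nbhd⊆ : (x y : V) →
    SameAnn R (proj₁ x) (proj₁ y) ⇔ (Nbhd⊆ (ZDGraph R) x y × Nbhd⊆ (ZDGraph R) y x)
  SameAnn⇔Nbhd⊆×Nbhd⊆ x y = (Ann⊆⇔Nbhd⊆ x y ×-⇔ Ann⊆⇔Nbhd⊆ y x) ⇔-∘ SameAnn⇔Ann⊆×Ann⊆

module _ {R : CommutativeRing c ℓ} {S : CommutativeRing c′ ℓ′}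
  (R-reduced : Reduced R) (S-reduced : Reduced S) (f : ZDGraph R ≅ ZDGraph S) where
  private
    module R = CommutativeRing R
    module S = CommutativeRing S
    module R-reduced = ReducedRing R R-reduced
    module S-reduced = ReducedRing S S-reduced
    module R-ann = Annihilators R
    module S-ann = Annihilators S
  open _≅_ f
  open IsoProperties (ZDGraph-isSetoidGraph R) (ZDGraph-isSetoidGraph S) f using (Nbhd⊆-≅)
  open EquationalReasoning {k = equivalence}

  SameAnn-≅ : ∀ x y → SameAnn R (proj₁ x) (proj₁ y) ⇔ SameAnn S (proj₁ (to x)) (proj₁ (to y))
  SameAnn-≅ x y = begin
    SameAnn R (proj₁ x) (proj₁ y)
      ∼⟨ R-reduced.SameAnn⇔Nbhd⊆×Nbhd⊆ x y ⟩
    (Nbhd⊆ (ZDGraph R) x y × Nbhd⊆ (ZDGraph R) y x)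
      ∼⟨ Nbhd⊆-≅ ×-⇔ Nbhd⊆-≅ ⟩
    (Nbhd⊆ (ZDGraph S) (to x) (to y) × Nbhd⊆ (ZDGraph S) (to y) (to x))
      ∼⟨ ⇔-sym (S-reduced.SameAnn⇔Nbhd⊆×Nbhd⊆ (to x) (to y)) ⟩
    SameAnn S (proj₁ (to x)) (proj₁ (to y)) ∎

  Annihilates-≅ : ∀ x y →
    proj₁ x R.* proj₁ y R.≈ R.0# ⇔ proj₁ (to x) S.* proj₁ (to y) S.≈ S.0#
  Annihilates-≅ x y = begin
    proj₁ x R.* proj₁ y R.≈ R.0#             ∼⟨ ⇔-sym (R-reduced.Adj⇔*≈0 x y) ⟩
    Graph.Adj (ZDGraph R) x y                ∼⟨ adj x y ⟩
    Graph.Adj (ZDGraph S) (to x) (to y)      ∼⟨ S-reduced.Adj⇔*≈0 (to x) (to y) ⟩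
    proj₁ (to x) S.* proj₁ (to y) S.≈ S.0#   ∎

  compress-≅ : CZDGraph R ≅ CZDGraph S
  compress-≅ = record
    { to        = to
    ; from      = from
    ; to-cong   = λ {x} {y} → ⇔.to (SameAnn-≅ x y)
    ; from-cong = λ {x} {y} x∼y →
        ⇔.from (SameAnn-≅ (from x) (from y))
               (S-ann.SameAnn-resp-≈ (S.sym (to-from x)) (S.sym (to-from y)) x∼y)
    ; from-to   = λ x → R-ann.≈⇒SameAnn (from-to x)
    ; to-from   = λ y → S-ann.≈⇒SameAnn (to-from y)
    ; adj       = λ x y → ¬-cong-⇔ (SameAnn-≅ x y) ×-⇔ Lift-cong-⇔ (Annihilates-≅ x y)
    }

corollary2p1 : {c ℓ c′ ℓ′ : Level} (R : CommutativeRing c ℓ) (S : CommutativeRing c′ ℓ′) →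
    NontrivialRing R → NontrivialRing S → Reduced R → Reduced S →
    ZDGraph R ≅ ZDGraph S →
    (n : ℕ) → HasMdim (CZDGraph R) n ⇔ HasMdim (CZDGraph S) n
corollary2p1 R S _ _ R-reduced S-reduced f =
  HasMdim-≅ (CZDGraph-isSetoidGraph R) (CZDGraph-isSetoidGraph S) (compress-≅ R-reduced S-reduced f)
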